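{- Let $G$ be a graph and $k$ a positive integer. If $G$ has a spanning $k$-edge-colorable subgraph, then $G$ has a spanning maximum $k$-edge-colorable subgraph.
   Context: Graphs are finite, undirected, without loops, but may have multiple edges. A subgraph $H$ of $G$ is spanning if every vertex of $G$ has degree at least $1$ in $H$ (a vertex of $G$ not belonging to $H$ is considered to have degree $0$ in $H$). A $k$-edge-coloring of a graph is a partition of its edge set into $k$ matchings; a graph is $k$-edge-colorable if it has a $k$-edge-coloring. A subgraph $H$ of $G$ is a maximum $k$-edge-colorable subgraph if $H$ is $k$-edge-colorable and has the maximum possible number of edges among all $k$-edge-colorable subgraphs of $G$. -}

module Defs where

open import Data.Nat using (ℕ; _≤_)
open import Data.Fin using (Fin)
open import Data.Fin.Subset using (Subset; _∈_; ∣_∣)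
open import Data.Product using (Σ; ∃; _×_; _,_)
open import Data.Sum using (_⊎_)
open import Relation.Binary.PropositionalEquality using (_≡_; _≢_)
open import Relation.Nullary using (¬_)

-- A finite multigraph without loops: vertices Fin n, edges Fin m,
-- each edge has two (distinct) endpoints. Parallel edges are allowed.
record Graph : Set where
  field
    n     : ℕ
    m     : ℕ
    end₁  : Fin m → Fin n
    end₂  : Fin m → Fin n
    loopless : ∀ e → end₁ e ≢ end₂ e

open Graph public

Incident : (G : Graph) → Fin (m G) → Fin (n G) → Set
Incident G e v = (end₁ G e ≡ v) ⊎ (end₂ G e ≡ v)

Adjacent : (G : Graph) → Fin (m G) → Fin (m G) → Set
Adjacent G e f = Σ (Fin (n G)) λ v → Incident G e v × Incident G f v

-- A subgraph is given by its edge set (a subset of E(G)); vertices not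
-- covered by its edges have degree 0, so only the edge set matters for
-- the notions below.
SubG : Graph → Set
SubG G = Subset (m G)

size : (G : Graph) → SubG G → ℕ
size G H = ∣ H ∣

Spanning : (G : Graph) → SubG G → Set
Spanning G H = ∀ (v : Fin (n G)) → ∃ λ e → e ∈ H × Incident G e v

IsEdgeColoring : (G : Graph) (k : ℕ) → SubG G → (Fin (m G) → Fin k) → Set
IsEdgeColoring G k H c =
  ∀ e f → e ∈ H → f ∈ H → e ≢ f → Adjacent G e f → c e ≢ c f

EdgeColorable : (G : Graph) (k : ℕ) → SubG G → Set
EdgeColorable G k H = Σ (Fin (m G) → Fin k) λ c → IsEdgeColoring G k H c

MaxEdgeColorable : (G : Graph) (k : ℕ) → SubG G → Set
MaxEdgeColorable G k H =
  EdgeColorable G k H × (∀ H' → EdgeColorable G k H' → size G H' ≤ size G H)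

module Submission where

-- Fix a spanning subgraph H₀ of G with a proper
-- k-edge-colouring c₀.  Among all pairs (H , c) with c a proper
-- k-edge-colouring of H, choose one that first maximises |H| and then
-- maximises the number of "agreeing" edges e ∈ H ∩ H₀ with c e = c₀ e.
-- Such an H is a maximum k-edge-colourable subgraph, and it is spanning:
-- if a vertex v were uncovered, pick e₀ ∈ H₀ at v (e₀ ∉ H) and give it
-- colour c₀ e₀.  At most one edge f of H clashes with this choice (it
-- must meet e₀ at its other end, where H is properly coloured); deleting
-- f keeps |H| and strictly increases the agreement, since f itself
-- cannot agree with c₀ (it meets e₀ and carries colour c₀ e₀).

open import Defs
open import Data.Nat using (ℕ; NonZero; zero; suc; _≤_; _<_) renaming (_≟_ to _≟ⁿ_)
open import Data.Nat.Properties using (≤-antisym; ≤-reflexive; n≤1+n; <⇒≱)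
open import Data.Fin using (Fin; zero; suc) renaming (_≟_ to _≟ᶠ_)
open import Data.Fin.Properties using (any?; all?)
open import Data.Fin.Subset using (Subset; _∈_; _∉_; _⊆_; ∣_∣; inside; outside)
open import Data.Fin.Subset.Properties using (_∈?_; p⊂q⇒∣p∣<∣q∣)
open import Data.Bool using (Bool; true; false)
open import Data.Vec using (Vec; []; _∷_; lookup; tabulate; _[_]≔_)
open import Data.Vec.Properties using ([]=⇒lookup; lookup⇒[]=; lookup∘update; lookup∘update′; lookup∘tabulate; []≔-lookup; []≔-updates; []≔-minimal)
open import Data.List using (List; []; _∷_; [_]; filter; cartesianProduct; cartesianProductWith; allFin)
open import Data.List.Membership.Propositional using () renaming (_∈_ to _∈ˡ_)
open import Data.List.Membership.Propositional.Properties using (∈-cartesianProduct⁺; ∈-cartesianProductWith⁺; ∈-allFin; ∈-filter⁺)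
open import Data.List.Relation.Unary.Any using (here; there)
import Data.List.Relation.Unary.All as All
open import Data.List.Relation.Unary.All.Properties using (all-filter)
open import Data.List.Extrema.Nat using (argmax; argmax-all; f[xs]≤f[argmax])
open import Data.Product using (Σ; _×_; _,_; ∃; proj₁; proj₂)
open import Data.Sum using (inj₁; inj₂)
open import Relation.Unary using (Decidable)
open import Relation.Nullary using (¬_; Dec; yes; no; does; ¬?; contradiction)
open import Relation.Nullary.Decidable using (_×-dec_; _⊎-dec_; _→-dec_; dec-true)
open import Relation.Binary.PropositionalEquality using (_≡_; _≢_; refl; sym; trans; cong; subst)

Enumerates : {A : Set} → List A → Set
Enumerates {A} xs = ∀ (x : A) → x ∈ˡ xs

vectors : {A : Set} → List A → (k : ℕ) → List (Vec A k)
vectors xs zero    = [ [] ]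
vectors xs (suc k) = cartesianProductWith _∷_ xs (vectors xs k)

vectors-enumerates : {A : Set} {xs : List A} → Enumerates xs → (k : ℕ) → Enumerates (vectors xs k)
vectors-enumerates all zero    []       = here refl
vectors-enumerates all (suc k) (x ∷ v) = ∈-cartesianProductWith⁺ _∷_ (all x) (vectors-enumerates all k v)

pairs-enumerate : {A B : Set} {xs : List A} {ys : List B} →
  Enumerates xs → Enumerates ys → Enumerates (cartesianProduct xs ys)
pairs-enumerate allx ally (x , y) = ∈-cartesianProduct⁺ (allx x) (ally y)

booleans : List Bool
booleans = true ∷ false ∷ []

booleans-enumerate : Enumerates booleans
booleans-enumerate true  = here refl
booleans-enumerate false = there (here refl)

Maximiser : {A : Set} → (A → Set) → (A → ℕ) → Set
Maximiser {A} P μ = Σ A λ x → P x × (∀ y → P y → μ y ≤ μ x)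

-- On an enumerated type, a decidable property with a witness has a
-- witness maximising any ℕ-valued measure.  This is how "choose a
-- maximal object" is realised constructively.
maximiser : {A : Set} {P : A → Set} {xs : List A} → Enumerates xs → Decidable P →
  (μ : A → ℕ) (a : A) → P a → Maximiser P μ
maximiser {A} {xs = xs} all P? μ a pa =
  argmax μ a candidates , argmax-all μ pa (all-filter P? xs) ,
  λ y py → All.lookup (f[xs]≤f[argmax] a candidates) (∈-filter⁺ P? (all y) py)
  where
    candidates : List A
    candidates = filter P? xs

subsetOf : ∀ {n} {P : Fin n → Set} → Decidable P → Subset n
subsetOf P? = tabulate (λ i → does (P? i))

∈-subsetOf⁺ : ∀ {n} {P : Fin n → Set} (P? : Decidable P) {i} → P i → i ∈ subsetOf P?
∈-subsetOf⁺ P? {i} p = lookup⇒[]= i _ (trans (lookup∘tabulate _ i) (dec-true (P? i) p))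

∈-subsetOf⁻ : ∀ {n} {P : Fin n → Set} (P? : Decidable P) {i} → i ∈ subsetOf P? → P i
∈-subsetOf⁻ P? {i} i∈ with P? i | trans (sym (lookup∘tabulate _ i)) ([]=⇒lookup i∈)
... | yes p | _ = p
... | no _  | ()

∉⇒lookup≡outside : ∀ {n} (p : Subset n) x → x ∉ p → lookup p x ≡ outside
∉⇒lookup≡outside p x x∉p with lookup p x in eq
... | inside  = contradiction (lookup⇒[]= x p eq) x∉p
... | outside = refl

update-same : ∀ {n} (p : Subset n) x {b} → lookup p x ≡ b → p [ x ]≔ b ≡ p
update-same p x refl = []≔-lookup p x

∈-update⁻ : ∀ {n} (p : Subset n) {x y b} → y ∈ p [ x ]≔ b → y ≢ x → y ∈ p
∈-update⁻ p {x} {y} {b} y∈ y≢x =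
  lookup⇒[]= y p (trans (sym (lookup∘update′ y≢x p b)) ([]=⇒lookup y∈))

∉-deleted : ∀ {n} (p : Subset n) {x y} → y ∈ p [ x ]≔ outside → y ≢ x
∉-deleted p {x} y∈ refl with trans (sym ([]=⇒lookup y∈)) (lookup∘update x p outside)
... | ()

∣inserted∣≡suc∣deleted∣ : ∀ {n} (p : Subset n) x →
  ∣ p [ x ]≔ inside ∣ ≡ suc ∣ p [ x ]≔ outside ∣
∣inserted∣≡suc∣deleted∣ (_       ∷ p) zero    = refl
∣inserted∣≡suc∣deleted∣ (inside  ∷ p) (suc x) = cong suc (∣inserted∣≡suc∣deleted∣ p x)
∣inserted∣≡suc∣deleted∣ (outside ∷ p) (suc x) = ∣inserted∣≡suc∣deleted∣ p x

∣insert∣ : ∀ {n} (p : Subset n) {x} → x ∉ p → ∣ p [ x ]≔ inside ∣ ≡ suc ∣ p ∣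
∣insert∣ p {x} x∉p =
  trans (∣inserted∣≡suc∣deleted∣ p x) (cong (λ q → suc ∣ q ∣) (update-same p x (∉⇒lookup≡outside p x x∉p)))

∣delete∣ : ∀ {n} (p : Subset n) {x} → x ∈ p → ∣ p ∣ ≡ suc ∣ p [ x ]≔ outside ∣
∣delete∣ p {x} x∈p =
  trans (cong ∣_∣ (sym (update-same p x ([]=⇒lookup x∈p)))) (∣inserted∣≡suc∣deleted∣ p x)

module _ (G : Graph) where

  incident? : ∀ e v → Dec (Incident G e v)
  incident? e v = (end₁ G e ≟ᶠ v) ⊎-dec (end₂ G e ≟ᶠ v)

  adjacent? : ∀ e f → Dec (Adjacent G e f)
  adjacent? e f = any? λ v → incident? e v ×-dec incident? f v

  adjacent-sym : ∀ {e f} → Adjacent G e f → Adjacent G f e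
  adjacent-sym (v , e∋v , f∋v) = v , f∋v , e∋v

  isEdgeColoring? : ∀ k H c → Dec (IsEdgeColoring G k H c)
  isEdgeColoring? k H c =
    all? λ e → all? λ f → (e ∈? H) →-dec ((f ∈? H) →-dec (¬? (e ≟ᶠ f) →-dec
      (adjacent? e f →-dec ¬? (c e ≟ᶠ c f))))

  isEdgeColoring-ext : ∀ {k H} {c c′ : Fin (m G) → Fin k} → (∀ e → c e ≡ c′ e) →
    IsEdgeColoring G k H c → IsEdgeColoring G k H c′
  isEdgeColoring-ext c≗c′ ok e f e∈ f∈ e≢f e~f ce≡cf =
    ok e f e∈ f∈ e≢f e~f (trans (c≗c′ e) (trans ce≡cf (sym (c≗c′ f))))

  other-end-unique : ∀ {e v w w′} → Incident G e v → Incident G e w → Incident G e w′ →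
    w ≢ v → w′ ≢ v → w ≡ w′
  other-end-unique (inj₁ a) (inj₁ b) _        w≢v _    = contradiction (trans (sym b) a) w≢v
  other-end-unique (inj₁ a) (inj₂ b) (inj₁ c) _   w′≢v = contradiction (trans (sym c) a) w′≢v
  other-end-unique (inj₁ a) (inj₂ b) (inj₂ c) _   _    = trans (sym b) c
  other-end-unique (inj₂ a) (inj₁ b) (inj₁ c) _   _    = trans (sym b) c
  other-end-unique (inj₂ a) (inj₁ b) (inj₂ c) _   w′≢v = contradiction (trans (sym c) a) w′≢v
  other-end-unique (inj₂ a) (inj₂ b) _        w≢v _    = contradiction (trans (sym b) a) w≢v

  insert-coloured : ∀ {k H R} (cv : Vec (Fin k) (m G)) (e : Fin (m G)) (α : Fin k) →
    IsEdgeColoring G k H (lookup cv) → R ⊆ H →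
    (∀ g → g ∈ R → g ≢ e → Adjacent G e g → lookup cv g ≢ α) →
    IsEdgeColoring G k (R [ e ]≔ inside) (lookup (cv [ e ]≔ α))
  insert-coloured {R = R} cv e α ok R⊆H free g h g∈ h∈ g≢h g~h cg≡ch
    with g ≟ᶠ e | h ≟ᶠ e
  ... | yes refl | yes refl = g≢h refl
  ... | yes refl | no h≢e   =
    free h (∈-update⁻ R h∈ h≢e) h≢e g~h (trans (sym (lookup∘update′ h≢e cv α)) (trans (sym cg≡ch) (lookup∘update e cv α)))
  ... | no g≢e   | yes refl =
    free g (∈-update⁻ R g∈ g≢e) g≢e (adjacent-sym g~h) (trans (sym (lookup∘update′ g≢e cv α)) (trans cg≡ch (lookup∘update h cv α)))
  ... | no g≢e   | no h≢e   =
    ok g h (R⊆H (∈-update⁻ R g∈ g≢e)) (R⊆H (∈-update⁻ R h∈ h≢e)) g≢h g~h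
      (trans (sym (lookup∘update′ g≢e cv α)) (trans cg≡ch (lookup∘update′ h≢e cv α)))

module Exchange (G : Graph) (k : ℕ) (H₀ : SubG G) (c₀ : Fin (m G) → Fin k)
                (ok₀ : IsEdgeColoring G k H₀ c₀) where

  Edge : Set
  Edge = Fin (m G)

  State : Set
  State = SubG G × Vec (Fin k) (m G)

  Proper : State → Set
  Proper (H , cv) = IsEdgeColoring G k H (lookup cv)

  edges : State → ℕ
  edges (H , _) = size G H

  Agrees : State → Edge → Set
  Agrees (H , cv) e = e ∈ H × e ∈ H₀ × lookup cv e ≡ c₀ e

  agrees? : ∀ s → Decidable (Agrees s)
  agrees? (H , cv) e = (e ∈? H) ×-dec ((e ∈? H₀) ×-dec (lookup cv e ≟ᶠ c₀ e))

  agreement : State → ℕ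
  agreement s = ∣ subsetOf (agrees? s) ∣

  states : List State
  states = cartesianProduct (vectors booleans (m G)) (vectors (allFin k) (m G))

  states-enumerate : Enumerates states
  states-enumerate = pairs-enumerate (vectors-enumerates booleans-enumerate (m G))
                                     (vectors-enumerates ∈-allFin (m G))

  Covers : SubG G → Fin (n G) → Set
  Covers H v = ∃ λ e → e ∈ H × Incident G e v

  Improvement : State → Set
  Improvement s = Σ State λ s′ → Proper s′ × edges s ≤ edges s′ × agreement s < agreement s′

  insert-agreeing : ∀ H cv (R : SubG G) e₀ → Proper (H , cv) → e₀ ∉ H → e₀ ∈ H₀ → R ⊆ H →
    (∀ g → g ∈ R → g ≢ e₀ → Adjacent G e₀ g → lookup cv g ≢ c₀ e₀) →
    size G H ≤ suc (size G R) → (∀ {g} → Agrees (H , cv) g → g ∈ R) →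
    Improvement (H , cv)
  insert-agreeing H cv R e₀ ok e₀∉H e₀∈H₀ R⊆H free small keeps =
    s′ , insert-coloured G cv e₀ (c₀ e₀) ok R⊆H free ,
    subst (size G H ≤_) (sym (∣insert∣ R (λ e₀∈R → e₀∉H (R⊆H e₀∈R)))) small ,
    p⊂q⇒∣p∣<∣q∣ (grows , e₀ , ∈-subsetOf⁺ (agrees? s′) e₀-agrees ,
                 λ e₀∈ → e₀∉H (proj₁ (∈-subsetOf⁻ (agrees? (H , cv)) e₀∈)))
    where
      s′ : State
      s′ = R [ e₀ ]≔ inside , cv [ e₀ ]≔ c₀ e₀

      e₀-agrees : Agrees s′ e₀
      e₀-agrees = []≔-updates R e₀ , e₀∈H₀ , lookup∘update e₀ cv (c₀ e₀)

      grows : subsetOf (agrees? (H , cv)) ⊆ subsetOf (agrees? s′)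
      grows {g} g∈ with ∈-subsetOf⁻ (agrees? (H , cv)) g∈
      ... | ag@(g∈H , g∈H₀ , cg≡) = ∈-subsetOf⁺ (agrees? s′)
        ( []≔-minimal R g e₀ g≢e₀ (keeps ag) , g∈H₀ , trans (lookup∘update′ g≢e₀ cv (c₀ e₀)) cg≡ )
        where
          g≢e₀ : g ≢ e₀
          g≢e₀ refl = e₀∉H g∈H

  improve : ∀ H cv v → Proper (H , cv) → ¬ Covers H v → Covers H₀ v → Improvement (H , cv)
  improve H cv v ok uncovered (e₀ , e₀∈H₀ , e₀∋v)
    with any? (λ f → (f ∈? H) ×-dec ((lookup cv f ≟ᶠ c₀ e₀) ×-dec adjacent? G e₀ f))
  ... | no no-clash =
    insert-agreeing H cv H e₀ ok e₀∉H e₀∈H₀ (λ g∈ → g∈)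
      (λ g g∈ _ e₀~g cg≡ → no-clash (g , g∈ , cg≡ , e₀~g)) (n≤1+n _) proj₁
    where
      e₀∉H : e₀ ∉ H
      e₀∉H e₀∈ = uncovered (e₀ , e₀∈ , e₀∋v)
  ... | yes (f , f∈H , cf≡ , (w′ , e₀∋w′ , f∋w′)) =
    insert-agreeing H cv (H [ f ]≔ outside) e₀ ok e₀∉H e₀∈H₀ (λ g∈ → ∈-update⁻ H g∈ (∉-deleted H g∈))
      free (≤-reflexive (∣delete∣ H f∈H)) keeps
    where
      e₀∉H : e₀ ∉ H
      e₀∉H e₀∈ = uncovered (e₀ , e₀∈ , e₀∋v)

      away : ∀ {g w} → g ∈ H → Incident G g w → w ≢ v
      away g∈ g∋w refl = uncovered (_ , g∈ , g∋w)

      -- f is the only edge of H that clashes with e₀: another clashing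
      -- edge would meet f at the far end of e₀ with the same colour.
      free : ∀ g → g ∈ H [ f ]≔ outside → g ≢ e₀ → Adjacent G e₀ g → lookup cv g ≢ c₀ e₀
      free g g∈R _ (w , e₀∋w , g∋w) cg≡ = ok g f g∈H f∈H (∉-deleted H g∈R)
        (w , g∋w , subst (Incident G f) (sym w≡w′) f∋w′) (trans cg≡ (sym cf≡))
        where
          g∈H = ∈-update⁻ H g∈R (∉-deleted H g∈R)
          w≡w′ = other-end-unique G e₀∋v e₀∋w e₀∋w′ (away g∈H g∋w) (away f∈H f∋w′)

      -- f does not agree: in H₀ it meets e₀, so its H₀-colour is not c₀ e₀.
      keeps : ∀ {g} → Agrees (H , cv) g → g ∈ H [ f ]≔ outside
      keeps {g} (g∈H , g∈H₀ , cg≡) = []≔-minimal H g f g≢f g∈H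
        where
          g≢f : g ≢ f
          g≢f refl = ok₀ e₀ g e₀∈H₀ g∈H₀ (λ { refl → e₀∉H g∈H }) (w′ , e₀∋w′ , f∋w′)
                       (trans (sym cf≡) cg≡)

module Construction (G : Graph) (k : ℕ) (H₀ : SubG G) (c₀ : Fin (m G) → Fin k)
                    (ok₀ : IsEdgeColoring G k H₀ c₀) (spanning₀ : Spanning G H₀) where
  open Exchange G k H₀ c₀ ok₀

  proper? : Decidable Proper
  proper? (H , cv) = isEdgeColoring? G k H (lookup cv)

  tabulated-proper : ∀ H c → IsEdgeColoring G k H c → Proper (H , tabulate c)
  tabulated-proper H c = isEdgeColoring-ext G (λ e → sym (lookup∘tabulate c e))

  largest : Maximiser Proper edges
  largest = maximiser states-enumerate proper? edges (H₀ , tabulate c₀) (tabulated-proper H₀ c₀ ok₀)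

  Largest : State → Set
  Largest s = Proper s × edges s ≡ edges (proj₁ largest)

  largest? : Decidable Largest
  largest? s = proper? s ×-dec (edges s ≟ⁿ edges (proj₁ largest))

  best : Maximiser Largest agreement
  best = maximiser states-enumerate largest? agreement (proj₁ largest) (proj₁ (proj₂ largest) , refl)

  H : SubG G
  H = proj₁ (proj₁ best)

  colouring : Vec (Fin k) (m G)
  colouring = proj₂ (proj₁ best)

  proper : Proper (H , colouring)
  proper = proj₁ (proj₁ (proj₂ best))

  best-largest : size G H ≡ edges (proj₁ largest)
  best-largest = proj₂ (proj₁ (proj₂ best))

  maximum : ∀ H′ → EdgeColorable G k H′ → size G H′ ≤ size G H
  maximum H′ (c , ok) = subst (size G H′ ≤_) (sym best-largest)
    (proj₂ (proj₂ largest) (H′ , tabulate c) (tabulated-proper H′ c ok))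

  -- An uncovered vertex would yield an improvement of best that is still
  -- largest but agrees more, contradicting the choice of best.
  spanning : Spanning G H
  spanning v with any? (λ e → (e ∈? H) ×-dec incident? G e v)
  ... | yes covered = covered
  ... | no uncovered with improve H colouring v proper uncovered (spanning₀ v)
  ...   | s′ , proper′ , bigger , agrees-more =
    contradiction (proj₂ (proj₂ best) s′ (proper′ , still-largest)) (<⇒≱ agrees-more)
    where
      still-largest : edges s′ ≡ edges (proj₁ largest)
      still-largest = ≤-antisym (proj₂ (proj₂ largest) s′ proper′)
                                (subst (_≤ edges s′) best-largest bigger)

mainTheorem1 : (G : Graph) (k : ℕ) → NonZero k →
    Σ (SubG G) (λ H → Spanning G H × EdgeColorable G k H) →
    Σ (SubG G) (λ H → Spanning G H × MaxEdgeColorable G k H)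
mainTheorem1 G k _ (H₀ , spanning₀ , c₀ , ok₀) =
  H , spanning , (lookup colouring , proper) , maximum
  where open Construction G k H₀ c₀ ok₀ spanning₀
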